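{- Let $n\ge2$ be a natural number and let the free group $\mathbb F_2$ on generators $\sigma,\tau$ act on a set $\Omega$ so that every stabiliser $\mathrm{Stab}(z)=\{\gamma\in\mathbb F_2:\gamma\cdot z=z\}$ ($z\in\Omega$) is abelian. Define $\gamma_0:=\sigma^{n-1}$, $\gamma_1:=\tau\sigma^{n-2}$, and $\gamma_i:=\sigma^{ -i+1}\tau\sigma^{i-2}$ for $2\le i<n$. Let $\mathcal O$ be an orbit whose elements have nontrivial stabilisers, and let $\omega\neq\varepsilon$ be a reduced word of minimal length among non-identity elements of $\mathbb F_2$ fixing at least one element $x\in\mathcal O$. If $\omega=\sigma^{ -k}$ for some $k>0$, then there is a partition $\mathcal O=A_0^{\mathcal O}\sqcup\dots\sqcup A_{n-1}^{\mathcal O}\sqcup B_0^{\mathcal O}\sqcup\dots\sqcup B_{n-1}^{\mathcal O}$ such that $\gamma_i(B_i^{\mathcal O})=\mathcal O-A_i^{\mathcal O}$ for every $i<n$.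
   Context: For $\gamma\in\mathbb F_2$ and $E\subseteq\Omega$, $\gamma(E)=\{\gamma\cdot z:z\in E\}$. Elements of $\mathbb F_2$ are identified with reduced words; $\varepsilon$ is the empty word. -}

module Defs where

open import Data.Nat using (ℕ; zero; suc; _∸_; _≤_)
open import Data.Fin using (Fin; toℕ)
open import Data.List using (List; []; _∷_; foldr; length)
open import Data.Product using (_×_; _,_; proj₂)
open import Data.Unit using (⊤; tt)
open import Relation.Nullary using (¬_; Dec; yes; no)
open import Relation.Binary.PropositionalEquality using (_≡_; _≢_; refl)

data Letter : Set where
  σ⁺ σ⁻ τ⁺ τ⁻ : Letter

inv : Letter → Letter
inv σ⁺ = σ⁻
inv σ⁻ = σ⁺
inv τ⁺ = τ⁻
inv τ⁻ = τ⁺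

_≟L_ : (x y : Letter) → Dec (x ≡ y)
σ⁺ ≟L σ⁺ = yes refl
σ⁺ ≟L σ⁻ = no λ ()
σ⁺ ≟L τ⁺ = no λ ()
σ⁺ ≟L τ⁻ = no λ ()
σ⁻ ≟L σ⁺ = no λ ()
σ⁻ ≟L σ⁻ = yes refl
σ⁻ ≟L τ⁺ = no λ ()
σ⁻ ≟L τ⁻ = no λ ()
τ⁺ ≟L σ⁺ = no λ ()
τ⁺ ≟L σ⁻ = no λ ()
τ⁺ ≟L τ⁺ = yes refl
τ⁺ ≟L τ⁻ = no λ ()
τ⁻ ≟L σ⁺ = no λ ()
τ⁻ ≟L σ⁻ = no λ ()
τ⁻ ≟L τ⁺ = no λ ()
τ⁻ ≟L τ⁻ = yes refl

Word : Set
Word = List Letter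

Reduced : Word → Set
Reduced [] = ⊤
Reduced (x ∷ []) = ⊤
Reduced (x ∷ y ∷ w) = (y ≢ inv x) × Reduced (y ∷ w)

record F2 : Set where
  constructor ⟨_,_⟩
  field
    word    : Word
    reduced : Reduced word
open F2 public

cons : Letter → Word → Word
cons x [] = x ∷ []
cons x (y ∷ w) with y ≟L inv x
... | yes _ = w
... | no  _ = x ∷ y ∷ w

private
  tail-red : ∀ y w → Reduced (y ∷ w) → Reduced w
  tail-red y [] r = tt
  tail-red y (z ∷ w) (_ , r) = r

  cons-red : ∀ x w → Reduced w → Reduced (cons x w)
  cons-red x [] r = tt
  cons-red x (y ∷ w) r with y ≟L inv x
  ... | yes _ = tail-red y w r
  ... | no ne = ne , r

  mul-red : ∀ u v → Reduced v → Reduced (foldr cons v u)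
  mul-red [] v r = r
  mul-red (x ∷ u) v r = cons-red x (foldr cons v u) (mul-red u v r)

e : F2
e = ⟨ [] , tt ⟩

_*_ : F2 → F2 → F2
g * h = ⟨ foldr cons (word h) (word g) , mul-red (word g) (word h) (reduced h) ⟩
infixl 7 _*_

_≈_ : F2 → F2 → Set
g ≈ h = word g ≡ word h

len : F2 → ℕ
len g = length (word g)

σ σ⁻¹ τ : F2
σ = ⟨ σ⁺ ∷ [] , tt ⟩
σ⁻¹ = ⟨ σ⁻ ∷ [] , tt ⟩
τ = ⟨ τ⁺ ∷ [] , tt ⟩

_^_ : F2 → ℕ → F2
g ^ zero = e
g ^ suc k = g * (g ^ k)

record Action (Ω : Set) : Set where
  field
    _·_     : F2 → Ω → Ω
    act-resp : ∀ g h x → g ≈ h → g · x ≡ h · x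
    act-id  : ∀ x → e · x ≡ x
    act-mul : ∀ g h x → (g * h) · x ≡ g · (h · x)
  infixr 6 _·_

γ : (n : ℕ) → Fin n → F2
γ n i with toℕ i
... | zero = σ ^ (n ∸ 1)
... | suc zero = τ * (σ ^ (n ∸ 2))
... | suc (suc j) = ((σ⁻¹ ^ suc j) * τ) * (σ ^ j)

-- Since Stab(x) is abelian and contains ω = σ⁻ᵏ, it lies in the centraliser ⟨σ⟩ of σ⁻ᵏ, so
-- the points of the orbit correspond to cosets g⟨σ⟩.  Such a coset is recorded by the first
-- τ-letter of g, i.e. by the m and ± of g = σᵐ τ^{±1} ⋯ (or by the absence of any τ-letter).
-- In these coordinates the sets are A₀ = {none} ∪ {m > 0}, B₀ = {m ≤ 1 - n},
-- A_{i+1} = {σ⁻ⁱτ⋯} and B_{i+1} = {σ⁻ᵈτ⁻¹⋯} with d = n - 2 for i = 0 and d = i - 1 otherwise,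
-- and the identities γᵢ(Bᵢ) = 𝒪 - Aᵢ become ping-pong computations with reduced words.
module Submission where

open import Defs
open import Data.Bool using (Bool; true; false)
open import Data.Empty using (⊥; ⊥-elim)
open import Data.Fin using (Fin; toℕ; fromℕ<) renaming (zero to fzero; suc to fsuc)
open import Data.Fin.Properties using (toℕ-injective; toℕ<n; toℕ-fromℕ<)
open import Data.Integer as ℤ using (ℤ; +_; -_; -[1+_]; 0ℤ; 1ℤ; -1ℤ; +≤+; +<+; -<+)
import Data.Integer.Properties as ℤ
open import Data.List using ([]; _∷_; foldr; _++_; replicate; head)
open import Data.List.Properties using (foldr-++)
open import Data.List.Relation.Unary.All using (All; []; _∷_)
open import Data.List.Relation.Unary.All.Properties using (replicate⁺)
open import Data.Maybe using (just)
open import Data.Maybe.Properties using (just-injective)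
open import Data.Nat as ℕ using (ℕ; zero; suc; _≤_; _<_; z≤n; s≤s; z<s)
import Data.Nat.Properties as ℕ
open import Data.Product using (Σ; _×_; _,_; proj₁; proj₂; map₁)
open import Data.Sum using (_⊎_; inj₁; inj₂)
open import Data.Unit using (⊤; tt)
open import Function using (_∘_)
open import Relation.Nullary using (¬_; yes; no)
open import Relation.Binary.PropositionalEquality
  using (_≡_; _≢_; refl; sym; trans; cong; cong₂; subst; module ≡-Reasoning)
open ≡-Reasoning

infixr 5 _◃_
infix 8 _⁻¹

_◃_ : Word → Word → Word
u ◃ v = foldr cons v u

inv-involutive : ∀ x → inv (inv x) ≡ x
inv-involutive σ⁺ = refl
inv-involutive σ⁻ = refl
inv-involutive τ⁺ = refl
inv-involutive τ⁻ = refl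

inv-irreflexive : ∀ x → x ≢ inv x
inv-irreflexive σ⁺ ()
inv-irreflexive σ⁻ ()
inv-irreflexive τ⁺ ()
inv-irreflexive τ⁻ ()

reduced-tail : ∀ {x w} → Reduced (x ∷ w) → Reduced w
reduced-tail {w = []} _ = tt
reduced-tail {w = _ ∷ _} (_ , r) = r

reduced-head : ∀ {x w} → Reduced (x ∷ w) → head w ≢ just (inv x)
reduced-head {w = []} _ ()
reduced-head {w = _ ∷ _} (y≢x⁻¹ , _) refl = y≢x⁻¹ refl

cons-no-cancel : ∀ x w → head w ≢ just (inv x) → cons x w ≡ x ∷ w
cons-no-cancel x [] _ = refl
cons-no-cancel x (y ∷ w) y≢x⁻¹ with y ≟L inv x
... | yes refl = ⊥-elim (y≢x⁻¹ refl)
... | no _ = refl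

cons-of-reduced : ∀ {x w} → Reduced (x ∷ w) → cons x w ≡ x ∷ w
cons-of-reduced r = cons-no-cancel _ _ (reduced-head r)

cons-cancel : ∀ x w → cons x (inv x ∷ w) ≡ w
cons-cancel x w with inv x ≟L inv x
... | yes _ = refl
... | no ≢ = ⊥-elim (≢ refl)

cons-reduced : ∀ x {w} → Reduced w → Reduced (cons x w)
cons-reduced x {[]} _ = tt
cons-reduced x {y ∷ w} r with y ≟L inv x
... | yes _ = reduced-tail r
... | no y≢x⁻¹ = y≢x⁻¹ , r

◃-reduced : ∀ u {v} → Reduced v → Reduced (u ◃ v)
◃-reduced [] r = r
◃-reduced (x ∷ u) r = cons-reduced x (◃-reduced u r)

cons-inv-cancel : ∀ x {v} → Reduced v → cons x (cons (inv x) v) ≡ v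
cons-inv-cancel x {[]} _ = cons-cancel x []
cons-inv-cancel x {y ∷ v} r with y ≟L inv (inv x)
... | no _ = cons-cancel x (y ∷ v)
... | yes refl rewrite inv-involutive x = cons-of-reduced r

inv-cons-cancel : ∀ x {v} → Reduced v → cons (inv x) (cons x v) ≡ v
inv-cons-cancel x {v} r =
  subst (λ y → cons (inv x) (cons y v) ≡ v) (inv-involutive x) (cons-inv-cancel (inv x) r)

cons-◃ : ∀ x w {v} → Reduced v → cons x w ◃ v ≡ cons x (w ◃ v)
cons-◃ x [] _ = refl
cons-◃ x (y ∷ w) r with y ≟L inv x
... | yes refl = sym (cons-inv-cancel x (◃-reduced w r))
... | no _ = refl

◃-assoc : ∀ u w {v} → Reduced v → (u ◃ w) ◃ v ≡ u ◃ w ◃ v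
◃-assoc [] w _ = refl
◃-assoc (x ∷ u) w r = trans (cons-◃ x (u ◃ w) r) (cong (cons x) (◃-assoc u w r))

◃-identityʳ : ∀ {u} → Reduced u → u ◃ [] ≡ u
◃-identityʳ {[]} _ = refl
◃-identityʳ {x ∷ u} r = trans (cong (cons x) (◃-identityʳ (reduced-tail r))) (cons-of-reduced r)

inverse-word : Word → Word
inverse-word [] = []
inverse-word (x ∷ w) = inverse-word w ++ inv x ∷ []

inverse-word-◃ˡ : ∀ u {v} → Reduced v → inverse-word u ◃ u ◃ v ≡ v
inverse-word-◃ˡ [] _ = refl
inverse-word-◃ˡ (x ∷ u) {v} r = begin
  (inverse-word u ++ inv x ∷ []) ◃ cons x (u ◃ v)  ≡⟨ foldr-++ cons _ (inverse-word u) _ ⟩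
  inverse-word u ◃ cons (inv x) (cons x (u ◃ v))   ≡⟨ cong (inverse-word u ◃_) (inv-cons-cancel x (◃-reduced u r)) ⟩
  inverse-word u ◃ u ◃ v                           ≡⟨ inverse-word-◃ˡ u r ⟩
  v                                                ∎

inverse-word-◃ʳ : ∀ u {v} → Reduced v → u ◃ inverse-word u ◃ v ≡ v
inverse-word-◃ʳ [] _ = refl
inverse-word-◃ʳ (x ∷ u) {v} r = begin
  cons x (u ◃ (inverse-word u ++ inv x ∷ []) ◃ v)  ≡⟨ cong (cons x ∘ (u ◃_)) (foldr-++ cons v (inverse-word u) _) ⟩
  cons x (u ◃ inverse-word u ◃ cons (inv x) v)     ≡⟨ cong (cons x) (inverse-word-◃ʳ u (cons-reduced (inv x) r)) ⟩
  cons x (cons (inv x) v)                          ≡⟨ cons-inv-cancel x r ⟩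
  v                                                ∎

inverse-word-replicate : ∀ k x → inverse-word (replicate k x) ≡ replicate k (inv x)
inverse-word-replicate zero x = refl
inverse-word-replicate (suc k) x =
  trans (cong (_++ inv x ∷ []) (inverse-word-replicate k x)) (replicate-∷ʳ k)
  where
  replicate-∷ʳ : ∀ k → replicate k (inv x) ++ inv x ∷ [] ≡ inv x ∷ replicate k (inv x)
  replicate-∷ʳ zero = refl
  replicate-∷ʳ (suc k) = cong (inv x ∷_) (replicate-∷ʳ k)

replicate-cancel : ∀ k x {v} → Reduced v → replicate k x ◃ replicate k (inv x) ◃ v ≡ v
replicate-cancel k x {v} r =
  subst (λ w → replicate k x ◃ w ◃ v ≡ v) (inverse-word-replicate k x) (inverse-word-◃ʳ (replicate k x) r)

word-^ : ∀ x k → word (⟨ x ∷ [] , tt ⟩ ^ k) ≡ replicate k x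
word-^ x zero = refl
word-^ x (suc zero) = refl
word-^ x (suc (suc k)) =
  trans (cong (cons x) (word-^ x (suc k))) (cons-no-cancel x _ (inv-irreflexive x ∘ just-injective))

reduce : Word → F2
reduce w = ⟨ w ◃ [] , ◃-reduced w tt ⟩

reduce-* : ∀ w g → word (reduce w * g) ≡ w ◃ word g
reduce-* w g = ◃-assoc w [] (reduced g)

_⁻¹ : F2 → F2
g ⁻¹ = reduce (inverse-word (word g))

⁻¹-inverseˡ : ∀ g → (g ⁻¹ * g) ≈ e
⁻¹-inverseˡ g = begin
  word (g ⁻¹ * g)                      ≡⟨ reduce-* (inverse-word (word g)) g ⟩
  inverse-word (word g) ◃ word g       ≡⟨ cong (inverse-word (word g) ◃_) (sym (◃-identityʳ (reduced g))) ⟩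
  inverse-word (word g) ◃ word g ◃ []  ≡⟨ inverse-word-◃ˡ (word g) tt ⟩
  []                                   ∎

-- τ-at m true and τ-at m false are the signatures of σᵐ τ ⋯ and σᵐ τ⁻¹ ⋯ respectively.
data Signature : Set where
  σ-only : Signature
  τ-at   : ℤ → Bool → Signature

shift : ℤ → Signature → Signature
shift d σ-only = σ-only
shift d (τ-at m b) = τ-at (d ℤ.+ m) b

signature : Word → Signature
signature [] = σ-only
signature (σ⁺ ∷ w) = shift 1ℤ (signature w)
signature (σ⁻ ∷ w) = shift -1ℤ (signature w)
signature (τ⁺ ∷ w) = τ-at 0ℤ true
signature (τ⁻ ∷ w) = τ-at 0ℤ false

shift-shift : ∀ d d' t → shift d (shift d' t) ≡ shift (d ℤ.+ d') t
shift-shift d d' σ-only = refl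
shift-shift d d' (τ-at m b) = cong (λ m → τ-at m b) (sym (ℤ.+-assoc d d' m))

shift-identity : ∀ t → shift 0ℤ t ≡ t
shift-identity σ-only = refl
shift-identity (τ-at m b) = cong (λ m → τ-at m b) (ℤ.+-identityˡ m)

shift-inverseˡ : ∀ d t → shift (- d) (shift d t) ≡ t
shift-inverseˡ d t =
  trans (shift-shift (- d) d t) (trans (cong (λ d → shift d t) (ℤ.+-inverseˡ d)) (shift-identity t))

shift-inverseʳ : ∀ d t → shift d (shift (- d) t) ≡ t
shift-inverseʳ d t =
  trans (shift-shift d (- d) t) (trans (cong (λ d → shift d t) (ℤ.+-inverseʳ d)) (shift-identity t))

shift-injective : ∀ d {t t'} → shift d t ≡ shift d t' → t ≡ t'
shift-injective d {t} {t'} eq = begin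
  t                           ≡⟨ shift-inverseˡ d t ⟨
  shift (- d) (shift d t)     ≡⟨ cong (shift (- d)) eq ⟩
  shift (- d) (shift d t')    ≡⟨ shift-inverseˡ d t' ⟩
  t'                          ∎

shift-τ-at-0 : ∀ d b → shift d (τ-at 0ℤ b) ≡ τ-at d b
shift-τ-at-0 d b = cong (λ m → τ-at m b) (ℤ.+-identityʳ d)

shift-τ-at-neg : ∀ d b → shift d (τ-at (- d) b) ≡ τ-at 0ℤ b
shift-τ-at-neg d b = cong (λ m → τ-at m b) (ℤ.+-inverseʳ d)

τ-at-injective : ∀ {m m' b b'} → τ-at m b ≡ τ-at m' b' → m ≡ m'
τ-at-injective refl = refl

shift-σ-only : ∀ {d t} → shift d t ≡ σ-only → t ≡ σ-only
shift-σ-only {t = σ-only} _ = refl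

shift-negative-fixed⇒σ-only : ∀ k t → shift -[1+ k ] t ≡ t → t ≡ σ-only
shift-negative-fixed⇒σ-only k σ-only _ = refl
shift-negative-fixed⇒σ-only k (τ-at m b) eq = ⊥-elim (ℤ.<-irrefl (τ-at-injective eq) -[1+k]+m<m)
  where
  -[1+k]+m<m : -[1+ k ] ℤ.+ m ℤ.< m
  -[1+k]+m<m = ℤ.<-≤-trans (ℤ.+-monoˡ-< m -<+) (ℤ.≤-reflexive (ℤ.+-identityˡ m))

signature-cons-σ⁺ : ∀ w → signature (cons σ⁺ w) ≡ shift 1ℤ (signature w)
signature-cons-σ⁺ [] = refl
signature-cons-σ⁺ (y ∷ w) with y ≟L σ⁻
... | yes refl = sym (shift-inverseʳ 1ℤ (signature w))
... | no _ = refl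

signature-cons-σ⁻ : ∀ w → signature (cons σ⁻ w) ≡ shift -1ℤ (signature w)
signature-cons-σ⁻ [] = refl
signature-cons-σ⁻ (y ∷ w) with y ≟L σ⁺
... | yes refl = sym (shift-inverseˡ 1ℤ (signature w))
... | no _ = refl

signature-σ⁺-power : ∀ k w → signature (replicate k σ⁺ ◃ w) ≡ shift (+ k) (signature w)
signature-σ⁺-power zero w = sym (shift-identity (signature w))
signature-σ⁺-power (suc k) w = begin
  signature (cons σ⁺ (replicate k σ⁺ ◃ w))   ≡⟨ signature-cons-σ⁺ (replicate k σ⁺ ◃ w) ⟩
  shift 1ℤ (signature (replicate k σ⁺ ◃ w))   ≡⟨ cong (shift 1ℤ) (signature-σ⁺-power k w) ⟩
  shift 1ℤ (shift (+ k) (signature w))         ≡⟨ shift-shift 1ℤ (+ k) (signature w) ⟩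
  shift (+ suc k) (signature w)                ∎

signature-σ⁻-power : ∀ k w → signature (replicate k σ⁻ ◃ w) ≡ shift (- + k) (signature w)
signature-σ⁻-power zero w = sym (shift-identity (signature w))
signature-σ⁻-power (suc k) w = begin
  signature (cons σ⁻ (replicate k σ⁻ ◃ w))    ≡⟨ signature-cons-σ⁻ (replicate k σ⁻ ◃ w) ⟩
  shift -1ℤ (signature (replicate k σ⁻ ◃ w))   ≡⟨ cong (shift -1ℤ) (signature-σ⁻-power k w) ⟩
  shift -1ℤ (shift (- + k) (signature w))      ≡⟨ shift-shift -1ℤ (- + k) (signature w) ⟩
  shift (ℤ.pred (- + k)) (signature w)         ≡⟨ cong (λ d → shift d (signature w)) (ℤ.neg-suc k) ⟨
  shift (- + suc k) (signature w)              ∎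

data IsσLetter : Letter → Set where
  σ⁺ : IsσLetter σ⁺
  σ⁻ : IsσLetter σ⁻

σ-word⇒signature : ∀ {w} → All IsσLetter w → signature w ≡ σ-only
σ-word⇒signature [] = refl
σ-word⇒signature (σ⁺ ∷ ps) = cong (shift 1ℤ) (σ-word⇒signature ps)
σ-word⇒signature (σ⁻ ∷ ps) = cong (shift -1ℤ) (σ-word⇒signature ps)

signature⇒σ-word : ∀ w → signature w ≡ σ-only → All IsσLetter w
signature⇒σ-word [] _ = []
signature⇒σ-word (σ⁺ ∷ w) eq = σ⁺ ∷ signature⇒σ-word w (shift-σ-only eq)
signature⇒σ-word (σ⁻ ∷ w) eq = σ⁻ ∷ signature⇒σ-word w (shift-σ-only eq)

σ-word-or-same-head : ∀ u {p} → Reduced u → All IsσLetter p →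
                      All IsσLetter (u ◃ p) ⊎ head (u ◃ p) ≡ head u
σ-word-or-same-head [] _ ps = inj₁ ps
σ-word-or-same-head (x ∷ u) {p} r ps with u ◃ p | σ-word-or-same-head u (reduced-tail r) ps
... | [] | _ = inj₂ refl
... | y ∷ w | ih with y ≟L inv x
...   | no _ = inj₂ refl
...   | yes refl with ih
...     | inj₁ (_ ∷ ws) = inj₁ ws
...     | inj₂ head≡ = ⊥-elim (reduced-head r (sym head≡))

σ-word-head : ∀ {w y} → All IsσLetter w → head w ≡ just y → IsσLetter y
σ-word-head (p ∷ _) refl = p

head-◃-σ-word : ∀ {x u p} → Reduced (x ∷ u) → All IsσLetter p → ¬ IsσLetter (inv x) →
                head (u ◃ p) ≢ just (inv x)
head-◃-σ-word {u = u} r ps x⁻¹∉σ eq with σ-word-or-same-head u (reduced-tail r) ps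
... | inj₁ qs = x⁻¹∉σ (σ-word-head qs eq)
... | inj₂ head≡ = reduced-head r (trans (sym head≡) eq)

-- The letters of p can cancel only σ-letters of u, so the first τ-letter of u survives.
signature-◃-σ-word : ∀ u {p} → Reduced u → All IsσLetter p → signature (u ◃ p) ≡ signature u
signature-◃-σ-word [] _ ps = σ-word⇒signature ps
signature-◃-σ-word (σ⁺ ∷ u) {p} r ps =
  trans (signature-cons-σ⁺ (u ◃ p)) (cong (shift 1ℤ) (signature-◃-σ-word u (reduced-tail r) ps))
signature-◃-σ-word (σ⁻ ∷ u) {p} r ps =
  trans (signature-cons-σ⁻ (u ◃ p)) (cong (shift -1ℤ) (signature-◃-σ-word u (reduced-tail r) ps))
signature-◃-σ-word (τ⁺ ∷ u) {p} r ps = cong signature (cons-no-cancel τ⁺ (u ◃ p) (head-◃-σ-word r ps λ ()))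
signature-◃-σ-word (τ⁻ ∷ u) {p} r ps = cong signature (cons-no-cancel τ⁻ (u ◃ p) (head-◃-σ-word r ps λ ()))

centralises-σ⁻¹-power⇒σ-word : ∀ k c → (c * σ⁻¹ ^ suc k) ≈ (σ⁻¹ ^ suc k * c) → All IsσLetter (word c)
centralises-σ⁻¹-power⇒σ-word k c comm =
  signature⇒σ-word (word c) (shift-negative-fixed⇒σ-only k (signature (word c)) (sym fixed))
  where
  ω-σ-word : All IsσLetter (word (σ⁻¹ ^ suc k))
  ω-σ-word = subst (All IsσLetter) (sym (word-^ σ⁻ (suc k))) (replicate⁺ (suc k) σ⁻)
  fixed : signature (word c) ≡ shift -[1+ k ] (signature (word c))
  fixed = begin
    signature (word c)                                 ≡⟨ signature-◃-σ-word (word c) (reduced c) ω-σ-word ⟨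
    signature (word c ◃ word (σ⁻¹ ^ suc k))            ≡⟨ cong signature comm ⟩
    signature (word (σ⁻¹ ^ suc k) ◃ word c)            ≡⟨ cong (λ w → signature (w ◃ word c)) (word-^ σ⁻ (suc k)) ⟩
    signature (replicate (suc k) σ⁻ ◃ word c)          ≡⟨ signature-σ⁻-power (suc k) (word c) ⟩
    shift -[1+ k ] (signature (word c))                ∎

NonNegative NonPositive : Signature → Set
NonNegative (τ-at -[1+ _ ] _) = ⊥
NonNegative _ = ⊤
NonPositive (τ-at ℤ.+[1+ _ ] _) = ⊥
NonPositive _ = ⊤

signature-nonnegative : ∀ w → Reduced w → head w ≢ just σ⁻ → NonNegative (signature w)
signature-nonnegative [] _ _ = tt
signature-nonnegative (σ⁺ ∷ w) r _ with signature w | signature-nonnegative w (reduced-tail r) (reduced-head r)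
... | σ-only | _ = tt
... | τ-at (+ _) _ | _ = tt
signature-nonnegative (σ⁻ ∷ w) _ σ⁻∉head = ⊥-elim (σ⁻∉head refl)
signature-nonnegative (τ⁺ ∷ w) _ _ = tt
signature-nonnegative (τ⁻ ∷ w) _ _ = tt

signature-nonpositive : ∀ w → Reduced w → head w ≢ just σ⁺ → NonPositive (signature w)
signature-nonpositive [] _ _ = tt
signature-nonpositive (σ⁻ ∷ w) r _ with signature w | signature-nonpositive w (reduced-tail r) (reduced-head r)
... | σ-only | _ = tt
... | τ-at (+ 0) _ | _ = tt
... | τ-at -[1+ _ ] _ | _ = tt
signature-nonpositive (σ⁺ ∷ w) _ σ⁺∉head = ⊥-elim (σ⁺∉head refl)
signature-nonpositive (τ⁺ ∷ w) _ _ = tt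
signature-nonpositive (τ⁻ ∷ w) _ _ = tt

τ-letter : Bool → Letter
τ-letter true = τ⁺
τ-letter false = τ⁻

τ-at-0⇒τ-head : ∀ w {b} → Reduced w → signature w ≡ τ-at 0ℤ b → Σ Word λ w' → w ≡ τ-letter b ∷ w'
τ-at-0⇒τ-head (σ⁺ ∷ w) r eq with signature w | signature-nonnegative w (reduced-tail r) (reduced-head r)
τ-at-0⇒τ-head (σ⁺ ∷ w) r () | σ-only | _
τ-at-0⇒τ-head (σ⁺ ∷ w) r () | τ-at (+ _) _ | _
τ-at-0⇒τ-head (σ⁻ ∷ w) r eq with signature w | signature-nonpositive w (reduced-tail r) (reduced-head r)
τ-at-0⇒τ-head (σ⁻ ∷ w) r () | σ-only | _
τ-at-0⇒τ-head (σ⁻ ∷ w) r () | τ-at (+ 0) _ | _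
τ-at-0⇒τ-head (σ⁻ ∷ w) r () | τ-at -[1+ _ ] _ | _
τ-at-0⇒τ-head (τ⁺ ∷ w) r refl = w , refl
τ-at-0⇒τ-head (τ⁻ ∷ w) r refl = w , refl

signature-cons-τ⁺ : ∀ u → Reduced u → signature u ≡ τ-at 0ℤ false → signature (cons τ⁺ u) ≢ τ-at 0ℤ true
signature-cons-τ⁺ u r eq eq' with τ-at-0⇒τ-head u r eq
... | u' , refl with τ-at-0⇒τ-head u' (reduced-tail r) eq'
...   | _ , refl = proj₁ r refl

signature-cons-τ⁻ : ∀ u → signature u ≢ τ-at 0ℤ true → signature (cons τ⁻ u) ≡ τ-at 0ℤ false
signature-cons-τ⁻ [] _ = refl
signature-cons-τ⁻ (y ∷ u) ≢ with y ≟L τ⁺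
... | yes refl = ⊥-elim (≢ refl)
... | no _ = refl

module Partition (n' : ℕ) where
  n N : ℕ
  n = suc (suc n')
  N = suc n'

  τ⁻¹-depth : Fin N → ℕ
  τ⁻¹-depth fzero = n'
  τ⁻¹-depth (fsuc j) = toℕ j

  τ⁻¹-depth<N : ∀ i → τ⁻¹-depth i ℕ.< N
  τ⁻¹-depth<N fzero = ℕ.n<1+n n'
  τ⁻¹-depth<N (fsuc j) = ℕ.m<n⇒m<1+n (toℕ<n j)

  τ⁻¹-depth-injective : ∀ i j → τ⁻¹-depth i ≡ τ⁻¹-depth j → i ≡ j
  τ⁻¹-depth-injective fzero fzero _ = refl
  τ⁻¹-depth-injective fzero (fsuc j) eq = ⊥-elim (ℕ.<-irrefl (sym eq) (toℕ<n j))
  τ⁻¹-depth-injective (fsuc i) fzero eq = ⊥-elim (ℕ.<-irrefl eq (toℕ<n i))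
  τ⁻¹-depth-injective (fsuc i) (fsuc j) eq = cong fsuc (toℕ-injective eq)

  A B : Fin n → Signature → Set
  A fzero σ-only = ⊤
  A fzero (τ-at m _) = 0ℤ ℤ.< m
  A (fsuc i) t = t ≡ τ-at (- + toℕ i) true
  B fzero σ-only = ⊥
  B fzero (τ-at m _) = m ℤ.≤ - + N
  B (fsuc i) t = t ≡ τ-at (- + τ⁻¹-depth i) false

  -d≰-N : ∀ {d} → d ℕ.< N → ¬ (- + d ℤ.≤ - + N)
  -d≰-N d<N -d≤-N = ℕ.<⇒≱ d<N (ℤ.drop‿+≤+ (ℤ.neg-cancel-≤ -d≤-N))

  0≮-d : ∀ d → ¬ (0ℤ ℤ.< - + d)
  0≮-d d 0<-d = ℤ.<⇒≱ 0<-d ℤ.neg-≤-pos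

  classify-depth : ∀ d b → Σ (Fin n) λ i → A i (τ-at (- + d) b) ⊎ B i (τ-at (- + d) b)
  classify-depth d b with N ℕ.≤? d
  ... | yes N≤d = fzero , inj₂ (ℤ.neg-mono-≤ (+≤+ N≤d))
  ... | no N≰d with b | ℕ.≰⇒> N≰d
  ...   | true | d<N = fsuc (fromℕ< d<N) , inj₁ (cong (λ d → τ-at (- + d) true) (sym (toℕ-fromℕ< d<N)))
  ...   | false | d<N with ℕ.m<1+n⇒m<n∨m≡n d<N
  ...     | inj₁ d<n' = fsuc (fsuc (fromℕ< d<n')) , inj₂ (cong (λ d → τ-at (- + d) false) (sym (toℕ-fromℕ< d<n')))
  ...     | inj₂ refl = fsuc fzero , inj₂ refl

  classify : ∀ t → Σ (Fin n) λ i → A i t ⊎ B i t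
  classify σ-only = fzero , inj₁ tt
  classify (τ-at ℤ.+[1+ m ] b) = fzero , inj₁ (+<+ z<s)
  classify (τ-at (+ 0) b) = classify-depth 0 b
  classify (τ-at -[1+ m ] b) = classify-depth (suc m) b

  A-disjoint : ∀ i j {t} → A i t → A j t → i ≡ j
  A-disjoint fzero fzero _ _ = refl
  A-disjoint fzero (fsuc j) a refl = ⊥-elim (0≮-d (toℕ j) a)
  A-disjoint (fsuc i) fzero refl a = ⊥-elim (0≮-d (toℕ i) a)
  A-disjoint (fsuc i) (fsuc j) refl eq =
    cong fsuc (toℕ-injective (ℤ.+-injective (ℤ.neg-injective (τ-at-injective eq))))

  B-disjoint : ∀ i j {t} → B i t → B j t → i ≡ j
  B-disjoint fzero fzero _ _ = refl
  B-disjoint fzero (fsuc j) b refl = ⊥-elim (-d≰-N (τ⁻¹-depth<N j) b)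
  B-disjoint (fsuc i) fzero refl b = ⊥-elim (-d≰-N (τ⁻¹-depth<N i) b)
  B-disjoint (fsuc i) (fsuc j) refl eq =
    cong fsuc (τ⁻¹-depth-injective i j (ℤ.+-injective (ℤ.neg-injective (τ-at-injective eq))))

  A-B-disjoint : ∀ i j {t} → A i t → B j t → ⊥
  A-B-disjoint fzero fzero {τ-at m _} 0<m m≤-N = ℤ.<⇒≱ 0<m (ℤ.≤-trans m≤-N ℤ.neg-≤-pos)
  A-B-disjoint fzero (fsuc j) a refl = 0≮-d (τ⁻¹-depth j) a
  A-B-disjoint (fsuc i) fzero refl b = -d≰-N (toℕ<n i) b
  A-B-disjoint (fsuc i) (fsuc j) refl ()

  γ₀-word : ∀ q → word (γ n fzero * q) ≡ replicate N σ⁺ ◃ word q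
  γ₀-word q = cong (_◃ word q) (word-^ σ⁺ N)

  γ-word : ∀ i q → word (γ n (fsuc i) * q) ≡
           replicate (toℕ i) σ⁻ ◃ cons τ⁺ (replicate (τ⁻¹-depth i) σ⁺ ◃ word q)
  γ-word fzero q = begin
    ((τ⁺ ∷ []) ◃ word (σ ^ n')) ◃ word q    ≡⟨ ◃-assoc (τ⁺ ∷ []) (word (σ ^ n')) (reduced q) ⟩
    cons τ⁺ (word (σ ^ n') ◃ word q)         ≡⟨ cong (λ w → cons τ⁺ (w ◃ word q)) (word-^ σ⁺ n') ⟩
    cons τ⁺ (replicate n' σ⁺ ◃ word q)       ∎
  γ-word (fsuc j) q = begin
    ((s⁻ ◃ (τ⁺ ∷ [])) ◃ s⁺) ◃ word q         ≡⟨ ◃-assoc (s⁻ ◃ (τ⁺ ∷ [])) s⁺ (reduced q) ⟩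
    (s⁻ ◃ (τ⁺ ∷ [])) ◃ s⁺ ◃ word q           ≡⟨ ◃-assoc s⁻ (τ⁺ ∷ []) (◃-reduced s⁺ (reduced q)) ⟩
    s⁻ ◃ cons τ⁺ (s⁺ ◃ word q)               ≡⟨ cong₂ (λ u v → u ◃ cons τ⁺ (v ◃ word q)) (word-^ σ⁻ (suc a)) (word-^ σ⁺ a) ⟩
    replicate (suc a) σ⁻ ◃ cons τ⁺ (replicate a σ⁺ ◃ word q) ∎
    where
    a : ℕ
    a = toℕ j
    s⁻ s⁺ : Word
    s⁻ = word (σ⁻¹ ^ suc a)
    s⁺ = word (σ ^ a)

  B₀-shift-outside-A₀ : ∀ t → B fzero t → ¬ A fzero (shift (+ N) t)
  B₀-shift-outside-A₀ (τ-at m _) m≤-N 0<N+m =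
    ℤ.<⇒≱ 0<N+m (ℤ.≤-trans (ℤ.+-monoʳ-≤ (+ N) m≤-N) (ℤ.≤-reflexive (ℤ.+-inverseʳ (+ N))))

  outside-A₀-shift-B₀ : ∀ t → ¬ A fzero t → B fzero (shift (- + N) t)
  outside-A₀-shift-B₀ σ-only t∉A₀ = t∉A₀ tt
  outside-A₀-shift-B₀ (τ-at m _) m≯0 =
    ℤ.≤-trans (ℤ.+-monoʳ-≤ (- + N) (ℤ.≮⇒≥ m≯0)) (ℤ.≤-reflexive (ℤ.+-identityʳ (- + N)))

  γ-B-outside-A : ∀ i g → B i (signature (word g)) → ¬ A i (signature (word (γ n i * g)))
  γ-B-outside-A fzero g g∈B γg∈A = B₀-shift-outside-A₀ (signature (word g)) g∈B
    (subst (A fzero) (trans (cong signature (γ₀-word g)) (signature-σ⁺-power N (word g))) γg∈A)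
  γ-B-outside-A (fsuc i) g g∈B γg∈A =
    signature-cons-τ⁺ u (◃-reduced (replicate d σ⁺) (reduced g)) u-signature
      (shift-injective (- + a) (begin
        shift (- + a) (signature (cons τ⁺ u))              ≡⟨ signature-σ⁻-power a (cons τ⁺ u) ⟨
        signature (replicate a σ⁻ ◃ cons τ⁺ u)             ≡⟨ cong signature (γ-word i g) ⟨
        signature (word (γ n (fsuc i) * g))                ≡⟨ γg∈A ⟩
        τ-at (- + a) true                                  ≡⟨ shift-τ-at-0 (- + a) true ⟨
        shift (- + a) (τ-at 0ℤ true)                       ∎))
    where
    a d : ℕ
    a = toℕ i
    d = τ⁻¹-depth i
    u : Word
    u = replicate d σ⁺ ◃ word g
    u-signature : signature u ≡ τ-at 0ℤ false
    u-signature = begin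
      signature u                                 ≡⟨ signature-σ⁺-power d (word g) ⟩
      shift (+ d) (signature (word g))            ≡⟨ cong (shift (+ d)) g∈B ⟩
      shift (+ d) (τ-at (- + d) false)            ≡⟨ shift-τ-at-neg (+ d) false ⟩
      τ-at 0ℤ false                               ∎

  outside-A₀-γ-B₀ : ∀ h → ¬ A fzero (signature (word h)) →
                    Σ F2 λ c → (γ n fzero * c) ≈ h × B fzero (signature (word c))
  outside-A₀-γ-B₀ h h∉A = reduce (replicate N σ⁻) * h , γc≈h , c∈B
    where
    c-word : word (reduce (replicate N σ⁻) * h) ≡ replicate N σ⁻ ◃ word h
    c-word = reduce-* (replicate N σ⁻) h
    γc≈h : (γ n fzero * (reduce (replicate N σ⁻) * h)) ≈ h
    γc≈h = trans (γ₀-word (reduce (replicate N σ⁻) * h)) (trans (cong (replicate N σ⁺ ◃_) c-word) (replicate-cancel N σ⁺ (reduced h)))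
    c∈B : B fzero (signature (word (reduce (replicate N σ⁻) * h)))
    c∈B = subst (B fzero) (sym (trans (cong signature c-word) (signature-σ⁻-power N (word h))))
                (outside-A₀-shift-B₀ (signature (word h)) h∉A)
  outside-A-γ-B-suc : ∀ i h → ¬ A (fsuc i) (signature (word h)) →
                      Σ F2 λ c → (γ n (fsuc i) * c) ≈ h × B (fsuc i) (signature (word c))
  outside-A-γ-B-suc i h h∉A = c , γc≈h , c∈B
    where
    a d : ℕ
    a = toℕ i
    d = τ⁻¹-depth i
    u : Word
    u = replicate a σ⁺ ◃ word h
    u-reduced : Reduced u
    u-reduced = ◃-reduced (replicate a σ⁺) (reduced h)
    c : F2
    c = reduce (replicate d σ⁻ ++ τ⁻ ∷ replicate a σ⁺) * h
    c-word : word c ≡ replicate d σ⁻ ◃ cons τ⁻ u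
    c-word = trans (reduce-* (replicate d σ⁻ ++ τ⁻ ∷ replicate a σ⁺) h)
                   (foldr-++ cons (word h) (replicate d σ⁻) (τ⁻ ∷ replicate a σ⁺))
    γc≈h : word (γ n (fsuc i) * c) ≡ word h
    γc≈h = begin
      word (γ n (fsuc i) * c)                                        ≡⟨ γ-word i c ⟩
      replicate a σ⁻ ◃ cons τ⁺ (replicate d σ⁺ ◃ word c)            ≡⟨ cong (λ w → replicate a σ⁻ ◃ cons τ⁺ (replicate d σ⁺ ◃ w)) c-word ⟩
      replicate a σ⁻ ◃ cons τ⁺ (replicate d σ⁺ ◃ replicate d σ⁻ ◃ cons τ⁻ u)
        ≡⟨ cong (λ w → replicate a σ⁻ ◃ cons τ⁺ w) (replicate-cancel d σ⁺ (cons-reduced τ⁻ u-reduced)) ⟩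
      replicate a σ⁻ ◃ cons τ⁺ (cons τ⁻ u)                           ≡⟨ cong (replicate a σ⁻ ◃_) (cons-inv-cancel τ⁺ u-reduced) ⟩
      replicate a σ⁻ ◃ replicate a σ⁺ ◃ word h                       ≡⟨ replicate-cancel a σ⁻ (reduced h) ⟩
      word h                                                         ∎
    u-not-τ : signature u ≢ τ-at 0ℤ true
    u-not-τ eq = h∉A (shift-injective (+ a) (begin
      shift (+ a) (signature (word h))     ≡⟨ signature-σ⁺-power a (word h) ⟨
      signature u                          ≡⟨ eq ⟩
      τ-at 0ℤ true                         ≡⟨ shift-τ-at-neg (+ a) true ⟨
      shift (+ a) (τ-at (- + a) true)      ∎))
    c∈B : signature (word c) ≡ τ-at (- + d) false
    c∈B = begin
      signature (word c)                            ≡⟨ cong signature c-word ⟩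
      signature (replicate d σ⁻ ◃ cons τ⁻ u)        ≡⟨ signature-σ⁻-power d (cons τ⁻ u) ⟩
      shift (- + d) (signature (cons τ⁻ u))         ≡⟨ cong (shift (- + d)) (signature-cons-τ⁻ u u-not-τ) ⟩
      shift (- + d) (τ-at 0ℤ false)                 ≡⟨ shift-τ-at-0 (- + d) false ⟩
      τ-at (- + d) false                            ∎

  outside-A-γ-B : ∀ i h → ¬ A i (signature (word h)) →
                  Σ F2 λ c → (γ n i * c) ≈ h × B i (signature (word c))
  outside-A-γ-B fzero = outside-A₀-γ-B₀
  outside-A-γ-B (fsuc i) = outside-A-γ-B-suc i

module _ {Ω : Set} (α : Action Ω) where
  open Action α

  ⁻¹-act-cancel : ∀ g z → g ⁻¹ · g · z ≡ z
  ⁻¹-act-cancel g z = begin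
    g ⁻¹ · g · z      ≡⟨ act-mul (g ⁻¹) g z ⟨
    (g ⁻¹ * g) · z    ≡⟨ act-resp (g ⁻¹ * g) e z (⁻¹-inverseˡ g) ⟩
    e · z             ≡⟨ act-id z ⟩
    z                 ∎

  Orbit : Ω → Ω → Set
  Orbit x y = Σ F2 λ g → g · x ≡ y

  orbit-trans : ∀ {x y z} → Orbit x y → Orbit y z → Orbit x z
  orbit-trans (g , refl) (h , refl) = h * g , act-mul h g _

  orbit-sym : ∀ {x y} → Orbit x y → Orbit y x
  orbit-sym (g , refl) = g ⁻¹ , ⁻¹-act-cancel g _

  signature-orbit-invariant : ∀ {x} k → (∀ c → c · x ≡ x → (c * σ⁻¹ ^ suc k) ≈ (σ⁻¹ ^ suc k * c)) →
                              ∀ g h → g · x ≡ h · x → signature (word g) ≡ signature (word h)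
  signature-orbit-invariant {x} k stab-centralises g h gx≡hx = begin
    signature (word g)                 ≡⟨ cong signature g≡hc ⟨
    signature (word h ◃ word c)        ≡⟨ signature-◃-σ-word (word h) (reduced h) c-σ-word ⟩
    signature (word h)                 ∎
    where
    c : F2
    c = h ⁻¹ * g
    c-fixes-x : c · x ≡ x
    c-fixes-x = trans (act-mul (h ⁻¹) g x) (trans (cong (h ⁻¹ ·_) gx≡hx) (⁻¹-act-cancel h x))
    c-σ-word : All IsσLetter (word c)
    c-σ-word = centralises-σ⁻¹-power⇒σ-word k c (stab-centralises c c-fixes-x)
    g≡hc : word h ◃ word c ≡ word g
    g≡hc = trans (cong (word h ◃_) (reduce-* (inverse-word (word h)) g)) (inverse-word-◃ʳ (word h) (reduced g))

  module OrbitPartition (n' : ℕ) (x : Ω) (k : ℕ)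
    (stab-centralises : ∀ c → c · x ≡ x → (c * σ⁻¹ ^ suc k) ≈ (σ⁻¹ ^ suc k * c)) where
    open Partition n'

    Aᴼ Bᴼ : Fin n → Ω → Set
    Aᴼ i y = Σ F2 λ g → g · x ≡ y × A i (signature (word g))
    Bᴼ i y = Σ F2 λ g → g · x ≡ y × B i (signature (word g))

    transport : ∀ (P : Signature → Set) {g h y} → g · x ≡ y → h · x ≡ y →
                P (signature (word h)) → P (signature (word g))
    transport P gx≡y hx≡y = subst P (signature-orbit-invariant k stab-centralises _ _ (trans hx≡y (sym gx≡y)))

    Aᴼ⊆orbit : ∀ {i y} → Aᴼ i y → Orbit x y
    Aᴼ⊆orbit (g , gx≡y , _) = g , gx≡y

    Bᴼ⊆orbit : ∀ {i y} → Bᴼ i y → Orbit x y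
    Bᴼ⊆orbit (g , gx≡y , _) = g , gx≡y

    orbit⊆Aᴼ∪Bᴼ : ∀ {y} → Orbit x y → Σ (Fin n) λ i → Aᴼ i y ⊎ Bᴼ i y
    orbit⊆Aᴼ∪Bᴼ (g , gx≡y) with classify (signature (word g))
    ... | i , inj₁ g∈A = i , inj₁ (g , gx≡y , g∈A)
    ... | i , inj₂ g∈B = i , inj₂ (g , gx≡y , g∈B)

    Aᴼ-disjoint : ∀ i j y → Aᴼ i y → Aᴼ j y → i ≡ j
    Aᴼ-disjoint i j _ (g , gx≡y , g∈A) (h , hx≡y , h∈A) = A-disjoint i j g∈A (transport (A j) gx≡y hx≡y h∈A)

    Bᴼ-disjoint : ∀ i j y → Bᴼ i y → Bᴼ j y → i ≡ j
    Bᴼ-disjoint i j _ (g , gx≡y , g∈B) (h , hx≡y , h∈B) = B-disjoint i j g∈B (transport (B j) gx≡y hx≡y h∈B)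

    Aᴼ-Bᴼ-disjoint : ∀ i j y → Aᴼ i y → Bᴼ j y → ⊥
    Aᴼ-Bᴼ-disjoint i j _ (g , gx≡y , g∈A) (h , hx≡y , h∈B) = A-B-disjoint i j g∈A (transport (B j) gx≡y hx≡y h∈B)

    γ-Bᴼ-outside-Aᴼ : ∀ i {y} → (Σ Ω λ z → Bᴼ i z × γ n i · z ≡ y) → Orbit x y × ¬ Aᴼ i y
    γ-Bᴼ-outside-Aᴼ i (z , (g , refl , g∈B) , refl) =
      (γ n i * g , act-mul (γ n i) g x) ,
      λ (h , hx≡y , h∈A) → γ-B-outside-A i g g∈B (transport (A i) (act-mul (γ n i) g x) hx≡y h∈A)

    outside-Aᴼ-γ-Bᴼ : ∀ i {y} → Orbit x y → ¬ Aᴼ i y → Σ Ω λ z → Bᴼ i z × γ n i · z ≡ y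
    outside-Aᴼ-γ-Bᴼ i (h , hx≡y) y∉Aᴼ with outside-A-γ-B i h (λ h∈A → y∉Aᴼ (h , hx≡y , h∈A))
    ... | c , γc≈h , c∈B =
      c · x , (c , refl , c∈B) , trans (sym (act-mul (γ n i) c x)) (trans (act-resp _ h x γc≈h) hx≡y)

lemma4p7 : (n : ℕ) → 2 ≤ n →
    (Ω : Set) (A : Action Ω) →
    let open Action A in
    (∀ (z : Ω) (g h : F2) → g · z ≡ z → h · z ≡ z → (g * h) ≈ (h * g)) →
    (𝒪 : Ω → Set) →
    (Σ Ω λ x₀ → ∀ y → (𝒪 y → Σ F2 λ g → g · x₀ ≡ y) × ((Σ F2 λ g → g · x₀ ≡ y) → 𝒪 y)) →
    (∀ y → 𝒪 y → Σ F2 λ g → ¬ (g ≈ e) × (g · y ≡ y)) →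
    (ω : F2) → ¬ (ω ≈ e) →
    (Σ Ω λ x → 𝒪 x × (ω · x ≡ x)) →
    (∀ (g : F2) → ¬ (g ≈ e) → (Σ Ω λ x → 𝒪 x × (g · x ≡ x)) → len ω ≤ len g) →
    (k : ℕ) → 0 < k → ω ≈ (σ⁻¹ ^ k) →
    Σ (Fin n → Ω → Set) λ Aᴼ → Σ (Fin n → Ω → Set) λ Bᴼ →
      (∀ i y → Aᴼ i y → 𝒪 y) × (∀ i y → Bᴼ i y → 𝒪 y) ×
      (∀ y → 𝒪 y → Σ (Fin n) λ i → Aᴼ i y ⊎ Bᴼ i y) ×
      (∀ i j y → Aᴼ i y → Aᴼ j y → i ≡ j) ×
      (∀ i j y → Bᴼ i y → Bᴼ j y → i ≡ j) ×
      (∀ i j y → Aᴼ i y → Bᴼ j y → ⊥) ×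
      (∀ i y → ((Σ Ω λ z → Bᴼ i z × (γ n i · z ≡ y)) → 𝒪 y × ¬ Aᴼ i y)
             × (𝒪 y × ¬ Aᴼ i y → Σ Ω λ z → Bᴼ i z × (γ n i · z ≡ y)))
lemma4p7 (suc (suc n')) (s≤s (s≤s z≤n)) Ω A comm 𝒪 (x₀ , 𝒪-orbit) _ ω _ (x , x∈𝒪 , ωx≡x) _ (suc k) (s≤s z≤n) ω≈ =
  Aᴼ , Bᴼ ,
  (λ _ _ → to-𝒪 ∘ Aᴼ⊆orbit) , (λ _ _ → to-𝒪 ∘ Bᴼ⊆orbit) ,
  (λ _ → orbit⊆Aᴼ∪Bᴼ ∘ from-𝒪) ,
  Aᴼ-disjoint , Bᴼ-disjoint , Aᴼ-Bᴼ-disjoint ,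
  λ i y → map₁ to-𝒪 ∘ γ-Bᴼ-outside-Aᴼ i , λ (y∈𝒪 , y∉Aᴼ) → outside-Aᴼ-γ-Bᴼ i (from-𝒪 y∈𝒪) y∉Aᴼ
  where
  open Action A
  x₀∼x : Orbit A x₀ x
  x₀∼x = proj₁ (𝒪-orbit x) x∈𝒪
  to-𝒪 : ∀ {y} → Orbit A x y → 𝒪 y
  to-𝒪 {y} x∼y = proj₂ (𝒪-orbit y) (orbit-trans A x₀∼x x∼y)
  from-𝒪 : ∀ {y} → 𝒪 y → Orbit A x y
  from-𝒪 {y} y∈𝒪 = orbit-trans A (orbit-sym A x₀∼x) (proj₁ (𝒪-orbit y) y∈𝒪)
  stab-centralises : ∀ c → c · x ≡ x → (c * σ⁻¹ ^ suc k) ≈ (σ⁻¹ ^ suc k * c)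
  stab-centralises c cx≡x = subst (λ w → word c ◃ w ≡ w ◃ word c) ω≈ (comm x c ω cx≡x ωx≡x)
  open OrbitPartition A n' x k stab-centralises
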